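{- Let $N$ be a rooted cactus without elementary vertices. Then the vertex-labelled tree $(U_N,\lambda_N)$ (the labelled unfolding of $N$) is a special pair with label set $K\subseteq\{x_1=x,\,x_2=r\}\cup\{y,z\}\cup\{s\}$.
   Context: A rooted cactus is a finite directed acyclic graph $N$ with exactly one vertex of indegree 0 (the root), such that every vertex is reachable from the root by a directed path and the underlying undirected graph is a cactus (connected, any two cycles edge-disjoint). A leaf is a vertex of outdegree 0, a reticulation a vertex of indegree 2, an elementary vertex one with indegree 1 and outdegree 1. A reticulation cycle for a reticulation $v$ is a pair of internally vertex-disjoint directed paths ending at $v$ with the same starting vertex $w$, the top vertex. The labelled unfolding $(U_N,\lambda_N)$ is built as follows. (A) For every vertex $v$ that is the top vertex of $c\ge1$ reticulation cycles, let $w_1,w_1',\dots,w_c,w_c'$ be children of $v$ such that each pair $(w_i,w_i')$ lies on the same reticulation cycle; for each $i$ add a new vertex $v_i$ with arc $(v,v_i)$, replace arcs $(v,w_i),(v,w_i')$ by $(v_i,w_i),(v_i,w_i')$, and label $v_i$ by $s$. Call the result $N'$. (B) While there is a reticulation, pick a lowest reticulation $v$ (none of its proper descendants is a reticulation); make a copy (with labels) of the rooted tree of descendants of $v$, with root $v'$, and replace one incoming arc $(w,v)$ by $(w,v')$; label $v,v'$ by $r$ if they are leaves and by $z$ otherwise. The result is a rooted tree $U_N$. (C) Label every still-unlabelled leaf $x$ and every other still-unlabelled vertex $y$; this gives $\lambda_N$. Special pair: for $K\subseteq\{x_1,x_2,\dots\}\cup\{y,z,s\}$ and a rooted tree $T$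 with $\lambda:V(T)\to K$, $(T,\lambda)$ is special if (i) every leaf has label in $\{x_1,x_2,\dots\}$; (ii) for every string (maximal directed path of outdegree-1 vertices) $(w_1,\dots,w_p)$, $\lambda(w_1)\in\{y,z\}$ and $\lambda(w_i)=y$ for $i\ge2$; (iii) every vertex neither a leaf nor in a string has label in $\{y,z,s\}$. -}

module Defs where

open import Data.Nat using (ℕ; zero; suc; _+_; _≤_; _≡ᵇ_)
open import Data.Fin using (Fin; splitAt) renaming (_≟_ to _≟F_)
open import Data.Bool using (Bool; true; false; _∧_; _∨_; not; if_then_else_)
open import Data.List using (List; []; _∷_; _++_; [_]; allFin; map; length)
open import Data.Nat.ListAction using (sum)
open import Data.Bool.ListAction using (any)
open import Data.List.Relation.Unary.All using (All)
open import Data.List.Relation.Unary.Unique.Propositional using (Unique)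
open import Data.List.Membership.Propositional using (_∈_)
open import Data.Maybe using (Maybe; just; nothing)
open import Data.Product using (Σ; ∃; _×_; _,_; proj₁; proj₂)
open import Data.Sum using (_⊎_; inj₁; inj₂)
open import Data.Empty using (⊥)
open import Relation.Nullary using (¬_; does)
open import Relation.Binary.PropositionalEquality using (_≡_; _≢_)
open import Relation.Binary.Construct.Closure.ReflexiveTransitive using (Star)
open import Function.Bundles using (_⇔_)
open import Function.Definitions using (Injective)

record Graph : Set where
  constructor mkGraph
  field
    size : ℕ
    arc  : Fin (size) → Fin (size) → Bool
open Graph public

Vtx : Graph → Set
Vtx G = Fin (size G)

Arc : (G : Graph) → Vtx G → Vtx G → Set
Arc G a b = arc G a b ≡ true

Reach : (G : Graph) → Vtx G → Vtx G → Set
Reach G = Star (Arc G)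

countB : ∀ {n} → (Fin n → Bool) → ℕ
countB {n} f = sum (map (λ u → if f u then 1 else 0) (allFin n))

indeg outdeg : (G : Graph) → Vtx G → ℕ
indeg G v = countB (λ u → arc G u v)
outdeg G v = countB (λ u → arc G v u)

eqF : ∀ {n} → Fin n → Fin n → Bool
eqF a b = does (a ≟F b)

anyFin : ∀ {m} → (Fin m → Bool) → Bool
anyFin {m} f = any f (allFin m)

data Consec {A : Set} : List A → A → A → Set where
  here  : ∀ {a b l} → Consec (a ∷ b ∷ l) a b
  there : ∀ {c a b l} → Consec l a b → Consec (c ∷ l) a b

lastOf : {A : Set} → A → List A → A
lastOf a [] = a
lastOf a (b ∷ l) = lastOf b l

Adj : (G : Graph) → Vtx G → Vtx G → Set
Adj G a b = Arc G a b ⊎ Arc G b a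

IsUCycle : (G : Graph) → Vtx G → List (Vtx G) → Set
IsUCycle G c cs =
  Unique (c ∷ cs) × (2 ≤ length cs) ×
  (∀ a b → Consec (c ∷ cs ++ [ c ]) a b → Adj G a b)

UEdge : {A : Set} → A → List A → A → A → Set
UEdge c cs a b = Consec (c ∷ cs ++ [ c ]) a b ⊎ Consec (c ∷ cs ++ [ c ]) b a

-- any two (distinct) cycles are edge-disjoint: cycles sharing an edge
-- have the same edge set (i.e. are the same cycle)
CactusCycles : Graph → Set
CactusCycles G = ∀ c₁ cs₁ c₂ cs₂ → IsUCycle G c₁ cs₁ → IsUCycle G c₂ cs₂ →
  (Σ (Vtx G) λ a → Σ (Vtx G) λ b → UEdge c₁ cs₁ a b × UEdge c₂ cs₂ a b) →
  ∀ a b → (UEdge c₁ cs₁ a b ⇔ UEdge c₂ cs₂ a b)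

Connected : Graph → Set
Connected G = ∀ a b → Star (Adj G) a b

Acyclic : Graph → Set
Acyclic G = ∀ a b → Arc G a b → ¬ Reach G b a

IsRoot : (G : Graph) → Vtx G → Set
IsRoot G r = indeg G r ≡ 0 × (∀ u → indeg G u ≡ 0 → u ≡ r) × (∀ u → Reach G r u)

record RootedCactus (N : Graph) : Set where
  field
    acyclic   : Acyclic N
    root      : Vtx N
    isRoot    : IsRoot N root
    connected : Connected N
    cactus    : CactusCycles N

NoElementary : Graph → Set
NoElementary N = ∀ v → ¬ (indeg N v ≡ 1 × outdeg N v ≡ 1)

-- Directed paths w → I → v  (I = list of interior vertices)

data DPath (G : Graph) : Vtx G → List (Vtx G) → Vtx G → Set where
  arcP  : ∀ {a b} → Arc G a b → DPath G a [] b
  consP : ∀ {a b c I} → Arc G a b → DPath G b I c → DPath G a (b ∷ I) c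

-- the vertex following the start on a path with interior I and end v
firstStep : ∀ {n} → List (Fin n) → Fin n → Fin n
firstStep [] v = v
firstStep (b ∷ _) _ = b

Disjoint : {A : Set} → List A → List A → Set
Disjoint I₁ I₂ = ∀ u → u ∈ I₁ → u ∈ I₂ → ⊥

-- reticulation cycle for reticulation v with top vertex w:
-- two distinct internally vertex-disjoint directed paths from w to v
RetCycle : (G : Graph) → Vtx G → List (Vtx G) → List (Vtx G) → Vtx G → Set
RetCycle G w I₁ I₂ v =
  indeg G v ≡ 2 × DPath G w I₁ v × DPath G w I₂ v × Disjoint I₁ I₂ ×
  ¬ (I₁ ≡ [] × I₂ ≡ [])

data Label : Set where
  lx lr ly lz ls : Label      -- x (= x₁), r (= x₂), y, z, s

record LGraph : Set where
  constructor mkLG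
  field
    lgraph : Graph
    llab   : Fin (size lgraph) → Maybe Label

record VLGraph : Set where
  constructor mkVL
  field
    tgraph : Graph
    tlab   : Fin (size tgraph) → Label

Triple : ℕ → Set
Triple n = Fin n × Fin n × Fin n

top c₁ c₂ : ∀ {n} → Triple n → Fin n
top (v , _ , _) = v
c₁ (_ , w , _) = w
c₂ (_ , _ , w') = w'

record ChoiceA (N : Graph) : Set where
  field
    m : ℕ
    -- the triples (v, wᵢ, wᵢ'), one per reticulation cycle
    t : Fin m → Triple (size N)
    sound : ∀ i → Σ (List (Vtx N)) λ I₁ → Σ (List (Vtx N)) λ I₂ → Σ (Vtx N) λ v →
      RetCycle N (top (t i)) I₁ I₂ v × firstStep I₁ v ≡ c₁ (t i) × firstStep I₂ v ≡ c₂ (t i)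
    complete : ∀ w I₁ I₂ v → RetCycle N w I₁ I₂ v →
      Σ (Fin m) λ i → (t i ≡ (w , firstStep I₁ v , firstStep I₂ v))
                     ⊎ (t i ≡ (w , firstStep I₂ v , firstStep I₁ v))
    -- every chosen arc (v , wᵢ) / (v , wᵢ') is used exactly once
    distinct : Injective _≡_ _≡_
      (λ (p : Fin m × Bool) → (top (t (proj₁ p)) ,
         (if proj₂ p then c₂ (t (proj₁ p)) else c₁ (t (proj₁ p)))))

module _ (N : Graph) (ch : ChoiceA N) where
  open ChoiceA ch

  arcA' : Fin (size N) ⊎ Fin m → Fin (size N) ⊎ Fin m → Bool
  arcA' (inj₁ a) (inj₁ b) = arc N a b ∧
    not (anyFin (λ i → eqF (top (t i)) a ∧ (eqF (c₁ (t i)) b ∨ eqF (c₂ (t i)) b)))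
  arcA' (inj₁ a) (inj₂ j) = eqF (top (t j)) a
  arcA' (inj₂ i) (inj₁ b) = eqF (c₁ (t i)) b ∨ eqF (c₂ (t i)) b
  arcA' (inj₂ _) (inj₂ _) = false

  labA' : Fin (size N) ⊎ Fin m → Maybe Label
  labA' (inj₁ _) = nothing
  labA' (inj₂ _) = just ls

  buildA : LGraph
  buildA = mkLG (mkGraph (size N + m) (λ a b → arcA' (splitAt (size N) a) (splitAt (size N) b)))
                (λ a → labA' (splitAt (size N) a))

record ChoiceB (G : LGraph) : Set where
  open LGraph G
  field
    v w    : Vtx lgraph
    retic  : indeg lgraph v ≡ 2
    lowest : ∀ a u → Arc lgraph v a → Reach lgraph a u → indeg lgraph u ≢ 2
    parent : Arc lgraph w v
    d      : ℕ
    D      : Fin d → Vtx lgraph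
    D-inj  : Injective _≡_ _≡_ D
    D-desc : ∀ u → (Reach lgraph v u ⇔ (Σ (Fin d) λ i → D i ≡ u))
    iv     : Fin d
    D-iv   : D iv ≡ v

module _ (G : LGraph) (ch : ChoiceB G) where
  open LGraph G
  open ChoiceB ch

  arcB' : Vtx lgraph ⊎ Fin d → Vtx lgraph ⊎ Fin d → Bool
  arcB' (inj₁ a) (inj₁ b) = arc lgraph a b ∧ not (eqF a w ∧ eqF b v)
  arcB' (inj₁ a) (inj₂ j) = eqF a w ∧ eqF j iv
  arcB' (inj₂ _) (inj₁ _) = false
  arcB' (inj₂ i) (inj₂ j) = arc lgraph (D i) (D j)

  rz : Label
  rz = if outdeg lgraph v ≡ᵇ 0 then lr else lz

  labB' : Vtx lgraph ⊎ Fin d → Maybe Label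
  labB' (inj₁ a) = if eqF a v then just rz else llab a
  labB' (inj₂ i) = if eqF i iv then just rz else llab (D i)

  buildB : LGraph
  buildB = mkLG (mkGraph (size lgraph + d)
                   (λ a b → arcB' (splitAt (size lgraph) a) (splitAt (size lgraph) b)))
                (λ a → labB' (splitAt (size lgraph) a))

data StepB (G : LGraph) : LGraph → Set where
  stepB : (ch : ChoiceB G) → StepB G (buildB G ch)

-- "while there is a reticulation, do a step (B)"
data BRun : LGraph → LGraph → Set where
  done : ∀ {G} → (∀ u → indeg (LGraph.lgraph G) u ≢ 2) → BRun G G
  step : ∀ {G G₁ G₂} → StepB G G₁ → BRun G₁ G₂ → BRun G G₂

stepC : LGraph → VLGraph
stepC (mkLG g l) = mkVL g (λ u → lab u (l u))
  where
  lab : Vtx g → Maybe Label → Label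
  lab _ (just k) = k
  lab u nothing = if outdeg g u ≡ᵇ 0 then lx else ly

record UnfoldingRun (N : Graph) : Set where
  field
    choiceA : ChoiceA N
    result  : LGraph
    run     : BRun (buildA N choiceA) result

labelledUnfolding : (N : Graph) → UnfoldingRun N → VLGraph
labelledUnfolding N ρ = stepC (UnfoldingRun.result ρ)

RootedTree : Graph → Set
RootedTree T = Σ (Vtx T) λ r →
  indeg T r ≡ 0 × (∀ u → u ≢ r → indeg T u ≡ 1) × (∀ u → Reach T r u)

-- (w ∷ ws) is a string: a maximal directed path of outdegree-1 vertices
IsString : (T : Graph) → Vtx T → List (Vtx T) → Set
IsString T w ws =
  (∀ a b → Consec (w ∷ ws) a b → Arc T a b) ×
  All (λ u → outdeg T u ≡ 1) (w ∷ ws) ×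
  (∀ p → Arc T p w → outdeg T p ≢ 1) ×
  (∀ c → Arc T (lastOf w ws) c → outdeg T c ≢ 1)

InString : (T : Graph) → Vtx T → Set
InString T u = Σ (Vtx T) λ w → Σ (List (Vtx T)) λ ws → IsString T w ws × u ∈ (w ∷ ws)

-- special pair with label set K ⊆ {x₁ = x, x₂ = r} ∪ {y, z} ∪ {s}
-- (the label set is enforced by the type Label)
Special : VLGraph → Set
Special (mkVL T λ') =
  RootedTree T ×
  (∀ u → outdeg T u ≡ 0 → (λ' u ≡ lx ⊎ λ' u ≡ lr)) ×
  (∀ w ws → IsString T w ws → (λ' w ≡ ly ⊎ λ' w ≡ lz) × All (λ u → λ' u ≡ ly) ws) ×
  (∀ u → outdeg T u ≢ 0 → ¬ InString T u → (λ' u ≡ ly ⊎ λ' u ≡ lz ⊎ λ' u ≡ ls))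

-- Step (A) keeps every vertex of N with its in-degree and adds s-vertices of in-degree 1
-- and out-degree 2.  Step (B) copies the descendants of a lowest reticulation v, which
-- below v form a tree; v then has in-degree 1, and out-degrees are unchanged under the map
-- sending copies back to their originals.  So in-degrees stay in {1, 2} off the root and
-- the final graph is a rooted tree.  Every label placed fits the out-degree (r: leaf,
-- z: not a leaf, s: out-degree 2), and the child of a vertex of out-degree 1 is never a
-- reticulation nor labelled z, so only the head of a string can carry z.  In N this last
-- property holds because a vertex whose only child is a reticulation is elementary, the
-- root, or a reticulation whose cycle would share an edge with its child's cycle.

module Submission where

open import Defs
open import Data.Nat using (ℕ; zero; suc; _+_; _≤_; s≤s; z≤n)
open import Data.Nat.Properties using (suc-injective)
open import Data.Fin using (Fin; zero; suc; splitAt; _↑ˡ_; _↑ʳ_) renaming (_≟_ to _≟F_)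
open import Data.Fin.Properties using (any?; splitAt-↑ˡ; splitAt-↑ʳ; splitAt⁻¹-↑ˡ; splitAt⁻¹-↑ʳ)
  renaming (suc-injective to Fin-suc-injective)
open import Data.Bool using (Bool; true; false; _∧_; _∨_; not; if_then_else_)
open import Data.Bool.Properties using (∧-zeroʳ; ∧-identityʳ; ∧-conicalˡ; ∧-conicalʳ; T-≡)
open import Data.List using (List; []; _∷_; _++_; [_]; length; tabulate; map; allFin)
open import Data.List.Properties using (++-assoc; ∷-injective)
open import Data.Nat.ListAction using (sum)
open import Data.List.Relation.Unary.All using (All; []; _∷_)
import Data.List.Relation.Unary.All as All
open import Data.List.Relation.Unary.Any using (satisfied)
open import Data.List.Relation.Unary.Any.Properties using (any⁺; any⁻)
open import Data.List.Relation.Unary.Any using (here; there)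
open import Data.List.Relation.Unary.AllPairs using ([]; _∷_)
open import Data.List.Relation.Unary.Unique.Propositional using (Unique)
open import Data.List.Relation.Unary.Unique.Propositional.Properties using (++⁺)
open import Data.List.Membership.Propositional using (_∈_; _∉_; lose)
open import Data.List.Membership.Propositional.Properties using (∈-++⁺ʳ; ∈-∃++; ∈-allFin)
open import Data.Maybe using (Maybe; just; nothing)
open import Data.Product using (Σ; _×_; _,_; proj₁; proj₂)
open import Data.Sum using (_⊎_; inj₁; inj₂; [_,_]′)
open import Data.Empty using (⊥; ⊥-elim)
open import Data.Unit using (⊤; tt)
open import Relation.Nullary using (¬_; ¬?; yes; no)
open import Relation.Nullary.Decidable using (dec-true; dec-false; decidable-stable; _×-dec_)
open import Relation.Binary.Definitions using (DecidableEquality)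
open import Relation.Binary.PropositionalEquality
  using (_≡_; _≢_; refl; sym; trans; cong; cong₂; subst; subst₂)
open import Relation.Binary.Construct.Closure.ReflexiveTransitive using (Star; ε; _◅_; _◅◅_)
  renaming (reverse to Star-reverse)
import Data.List.Relation.Unary.First as First
open import Data.List.Relation.Unary.First.Properties using (¬All⇒First; toView)
open import Function using (_∘_; id; flip)
open import Function.Bundles using (Equivalence)

false⇒¬true : ∀ {b : Bool} → b ≡ false → b ≢ true
false⇒¬true refl ()

eqF-refl : ∀ {n} (a : Fin n) → eqF a a ≡ true
eqF-refl a = dec-true (a ≟F a) refl

eqF-≢ : ∀ {n} {a b : Fin n} → a ≢ b → eqF a b ≡ false
eqF-≢ {a = a} {b} = dec-false (a ≟F b)

eqF-true : ∀ {n} {a b : Fin n} → eqF a b ≡ true → a ≡ b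
eqF-true {a = a} {b} e with a ≟F b
... | yes a≡b = a≡b

eqF-false : ∀ {n} {a b : Fin n} → eqF a b ≡ false → a ≢ b
eqF-false {a = a} {b} e with a ≟F b
... | no a≢b = a≢b

anyFin-true : ∀ {m} (f : Fin m → Bool) → anyFin f ≡ true → Σ (Fin m) λ i → f i ≡ true
anyFin-true f e with satisfied (any⁻ f (allFin _) (Equivalence.from T-≡ e))
... | i , fi = i , Equivalence.to T-≡ fi

anyFin-intro : ∀ {m} (f : Fin m → Bool) i → f i ≡ true → anyFin f ≡ true
anyFin-intro f i e = Equivalence.to T-≡ (any⁺ f (lose (∈-allFin i) (Equivalence.from T-≡ e)))

_without_ : ∀ {n} → (Fin n → Bool) → Fin n → Fin n → Bool
(f without y) z = f z ∧ not (eqF z y)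

without-true : ∀ {n} (f : Fin n → Bool) y z → (f without y) z ≡ true → f z ≡ true × z ≢ y
without-true f y z e with f z | eqF z y in z≟y
without-true f y z refl | true | false = refl , eqF-false z≟y

without-intro : ∀ {n} (f : Fin n → Bool) {y z} → f z ≡ true → z ≢ y → (f without y) z ≡ true
without-intro f fz z≢y rewrite fz | eqF-≢ z≢y = refl

private
  count : ∀ n → (Fin n → Bool) → ℕ
  count zero    f = 0
  count (suc n) f = (if f zero then 1 else 0) + count n (f ∘ suc)

  count-tabulate : ∀ {k} n (f : Fin k → Bool) (h : Fin n → Fin k) →
    sum (map (λ u → if f u then 1 else 0) (tabulate h)) ≡ count n (f ∘ h)
  count-tabulate zero    f h = refl
  count-tabulate (suc n) f h = cong (_ +_) (count-tabulate n f (h ∘ suc))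

  countB≡count : ∀ {n} (f : Fin n → Bool) → countB f ≡ count n f
  countB≡count {n} f = count-tabulate n f id

  count-cong : ∀ n (f g : Fin n → Bool) → (∀ x → f x ≡ g x) → count n f ≡ count n g
  count-cong zero    f g f≗g = refl
  count-cong (suc n) f g f≗g rewrite f≗g zero =
    cong (_ +_) (count-cong n (f ∘ suc) (g ∘ suc) (f≗g ∘ suc))

  count-none : ∀ n (f : Fin n → Bool) → (∀ x → f x ≡ false) → count n f ≡ 0
  count-none zero    f none = refl
  count-none (suc n) f none rewrite none zero = count-none n (f ∘ suc) (none ∘ suc)

  count≡0 : ∀ n (f : Fin n → Bool) → count n f ≡ 0 → ∀ x → f x ≡ false
  count≡0 (suc n) f c x with f zero in f0
  count≡0 (suc n) f c zero    | false = f0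
  count≡0 (suc n) f c (suc x) | false = count≡0 n (f ∘ suc) c x

  count-suc : ∀ n (f : Fin n → Bool) {k} → count n f ≡ suc k → Σ (Fin n) λ x → f x ≡ true
  count-suc (suc n) f c with f zero in f0
  ... | true  = zero , f0
  ... | false with count-suc n (f ∘ suc) c
  ...   | x , fx = suc x , fx

  without-suc : ∀ {n} (f : Fin (suc n) → Bool) y x →
    ((f ∘ suc) without y) x ≡ (f without suc y) (suc x)
  without-suc f y x with x ≟F y | suc x ≟F suc y
  ... | yes _   | yes _ = refl
  ... | no _    | no _  = refl
  ... | yes x≡y | no ≢  = ⊥-elim (≢ (cong suc x≡y))
  ... | no x≢y  | yes ≡ = ⊥-elim (x≢y (Fin-suc-injective ≡))

  count-without : ∀ n (f : Fin n → Bool) y → f y ≡ true → count n f ≡ suc (count n (f without y))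
  count-without (suc n) f zero fy rewrite fy =
    cong suc (count-cong n (f ∘ suc) ((f without zero) ∘ suc) λ x → sym (∧-true (f (suc x))))
    where
    ∧-true : ∀ b → (b ∧ true) ≡ b
    ∧-true true  = refl
    ∧-true false = refl
  count-without (suc n) f (suc y) fy
    rewrite count-without n (f ∘ suc) y fy
          | count-cong n ((f ∘ suc) without y) ((f without suc y) ∘ suc) (without-suc f y)
          | eqF-≢ {a = zero} {b = suc y} (λ ())
    with f zero
  ... | true  = refl
  ... | false = refl

  -- Induction on the domain: if f 0 holds, h 0 is switched off in g.
  count-bij : ∀ n m (f : Fin n → Bool) (g : Fin m → Bool) (h : Fin n → Fin m) →
    (∀ x → f x ≡ true → g (h x) ≡ true) →
    (∀ x y → f x ≡ true → f y ≡ true → h x ≡ h y → x ≡ y) →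
    (∀ y → g y ≡ true → Σ (Fin n) λ x → f x ≡ true × h x ≡ y) →
    count n f ≡ count m g
  count-bij zero m f g h maps inj onto = sym (count-none m g none)
    where
    none : ∀ y → g y ≡ false
    none y with g y in gy
    ... | false = refl
    ... | true with onto y gy
    ...   | () , _
  count-bij (suc n) m f g h maps inj onto with f zero in f0
  ... | true = trans (cong suc (count-bij n m (f ∘ suc) (g without h zero) (h ∘ suc) maps′ inj′ onto′))
                     (sym (count-without m g (h zero) (maps zero f0)))
    where
    maps′ : ∀ x → f (suc x) ≡ true → (g without h zero) (h (suc x)) ≡ true
    maps′ x fx = without-intro g (maps (suc x) fx) λ e → 0≢suc (inj zero (suc x) f0 fx (sym e))
      where
      0≢suc : zero ≢ suc x
      0≢suc ()
    inj′ : ∀ x y → f (suc x) ≡ true → f (suc y) ≡ true → h (suc x) ≡ h (suc y) → x ≡ y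
    inj′ x y fx fy e = Fin-suc-injective (inj (suc x) (suc y) fx fy e)
    onto′ : ∀ y → (g without h zero) y ≡ true → Σ (Fin n) λ x → f (suc x) ≡ true × h (suc x) ≡ y
    onto′ y e with without-true g (h zero) y e
    ... | gy , y≢h0 with onto y gy
    ...   | zero  , _  , h0≡y = ⊥-elim (y≢h0 (sym h0≡y))
    ...   | suc x , fx , hx≡y = x , fx , hx≡y
  ... | false = count-bij n m (f ∘ suc) g (h ∘ suc) (maps ∘ suc) inj′ onto′
    where
    inj′ : ∀ x y → f (suc x) ≡ true → f (suc y) ≡ true → h (suc x) ≡ h (suc y) → x ≡ y
    inj′ x y fx fy e = Fin-suc-injective (inj (suc x) (suc y) fx fy e)
    onto′ : ∀ y → g y ≡ true → Σ (Fin n) λ x → f (suc x) ≡ true × h (suc x) ≡ y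
    onto′ y gy with onto y gy
    ... | zero  , fx , _ with trans (sym fx) f0
    ...   | ()
    onto′ y gy | suc x , fx , hx≡y = x , fx , hx≡y

module _ {n : ℕ} where

  countB-bij : ∀ {m} (f : Fin n → Bool) (g : Fin m → Bool) (h : Fin n → Fin m) →
    (∀ x → f x ≡ true → g (h x) ≡ true) →
    (∀ x y → f x ≡ true → f y ≡ true → h x ≡ h y → x ≡ y) →
    (∀ y → g y ≡ true → Σ (Fin n) λ x → f x ≡ true × h x ≡ y) →
    countB f ≡ countB g
  countB-bij {m} f g h maps inj onto =
    trans (countB≡count f) (trans (count-bij n m f g h maps inj onto) (sym (countB≡count g)))

  countB-without : ∀ (f : Fin n → Bool) y → f y ≡ true → countB f ≡ suc (countB (f without y))
  countB-without f y fy =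
    trans (countB≡count f) (trans (count-without n f y fy) (cong suc (sym (countB≡count (f without y)))))

  countB-suc : ∀ (f : Fin n → Bool) {k} → countB f ≡ suc k → Σ (Fin n) λ x → f x ≡ true
  countB-suc f c = count-suc n f (trans (sym (countB≡count f)) c)

  countB≡0 : ∀ (f : Fin n → Bool) → countB f ≡ 0 → ∀ x → f x ≡ false
  countB≡0 f c = count≡0 n f (trans (sym (countB≡count f)) c)

  countB-another : ∀ (f : Fin n → Bool) {k x} → countB f ≡ suc (suc k) → f x ≡ true →
    Σ (Fin n) λ y → f y ≡ true × y ≢ x
  countB-another f {x = x} c fx with countB-suc (f without x) (suc-injective (trans (sym (countB-without f x fx)) c))
  ... | y , e = y , without-true f x y e

  countB-one : ∀ (f : Fin n → Bool) x → f x ≡ true → (∀ y → f y ≡ true → y ≡ x) → countB f ≡ 1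
  countB-one f x fx unique = trans (countB-without f x fx) (cong suc (trans (countB≡count (f without x)) (count-none n (f without x) none)))
    where
    none : ∀ z → (f without x) z ≡ false
    none z with (f without x) z in e
    ... | false = refl
    ... | true with without-true f x z e
    ...   | fz , z≢x = ⊥-elim (z≢x (unique z fz))

  countB≡1 : ∀ (f : Fin n → Bool) {x y} → countB f ≡ 1 → f x ≡ true → f y ≡ true → y ≡ x
  countB≡1 f {x} {y} c fx fy with y ≟F x
  ... | yes y≡x = y≡x
  ... | no y≢x with trans (sym (without-intro f fy y≢x))
                         (countB≡0 (f without x) (suc-injective (trans (sym (countB-without f x fx)) c)) y)
  ...   | ()

  countB-two : ∀ (f : Fin n → Bool) x y → x ≢ y → f x ≡ true → f y ≡ true →
    (∀ z → f z ≡ true → z ≡ x ⊎ z ≡ y) → countB f ≡ 2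
  countB-two f x y x≢y fx fy only =
    trans (countB-without f x fx) (cong suc (countB-one (f without x) y (without-intro f fy (x≢y ∘ sym)) only′))
    where
    only′ : ∀ z → (f without x) z ≡ true → z ≡ y
    only′ z e with without-true f x z e
    ... | fz , z≢x with only z fz
    ...   | inj₁ z≡x = ⊥-elim (z≢x z≡x)
    ...   | inj₂ z≡y = z≡y

  countB-three : ∀ (f : Fin n → Bool) {k} → countB f ≡ suc (suc (suc k)) →
    Σ (Fin n) λ x₁ → Σ (Fin n) λ x₂ → Σ (Fin n) λ x₃ →
    x₁ ≢ x₂ × x₁ ≢ x₃ × x₂ ≢ x₃ × f x₁ ≡ true × f x₂ ≡ true × f x₃ ≡ true
  countB-three f c with countB-suc f c
  ... | x₁ , f₁ with countB-another f c f₁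
  ... | x₂ , f₂ , x₂≢x₁
    with countB-another (f without x₁) (suc-injective (trans (sym (countB-without f x₁ f₁)) c))
                        (without-intro f f₂ x₂≢x₁)
  ... | x₃ , f₃′ , x₃≢x₂ with without-true f x₁ x₃ f₃′
  ... | f₃ , x₃≢x₁ = x₁ , x₂ , x₃ , x₂≢x₁ ∘ sym , x₃≢x₁ ∘ sym , x₃≢x₂ ∘ sym , f₁ , f₂ , f₃

module _ {A : Set} where

  consec-++ˡ : ∀ {xs ys : List A} {a b} → Consec xs a b → Consec (xs ++ ys) a b
  consec-++ˡ here      = here
  consec-++ˡ (there k) = there (consec-++ˡ k)

  consec-++ʳ : ∀ (xs : List A) {ys a b} → Consec ys a b → Consec (xs ++ ys) a b
  consec-++ʳ []       k = k
  consec-++ʳ (x ∷ xs) k = there (consec-++ʳ xs k)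

  consec-junction : ∀ (x : A) xs y ys → Consec ((x ∷ xs) ++ (y ∷ ys)) (lastOf x xs) y
  consec-junction x []       y ys = here
  consec-junction x (z ∷ xs) y ys = there (consec-junction z xs y ys)

  consec-++⁻ : ∀ (x : A) xs y ys {a b} → Consec ((x ∷ xs) ++ (y ∷ ys)) a b →
    Consec (x ∷ xs) a b ⊎ Consec (y ∷ ys) a b ⊎ (a ≡ lastOf x xs × b ≡ y)
  consec-++⁻ x []       y ys here      = inj₂ (inj₂ (refl , refl))
  consec-++⁻ x []       y ys (there k) = inj₂ (inj₁ k)
  consec-++⁻ x (z ∷ xs) y ys here      = inj₁ here
  consec-++⁻ x (z ∷ xs) y ys (there k) with consec-++⁻ z xs y ys k
  ... | inj₁ k′ = inj₁ (there k′)
  ... | inj₂ r  = inj₂ r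

  consec-into-last : ∀ (w : A) y ys → Σ A λ x → Consec (w ∷ y ∷ ys) x (lastOf y ys)
  consec-into-last w y []       = w , here
  consec-into-last w y (z ∷ ys) with consec-into-last y z ys
  ... | x , k = x , there k

  consec-∈ʳ : ∀ {z : A} {rest a b} → Consec (z ∷ rest) a b → b ∈ rest
  consec-∈ʳ here = here refl
  consec-∈ʳ {rest = _ ∷ _} (there k) = there (consec-∈ʳ k)

  consec-∈ˡ : ∀ (xs : List A) {c a b} → Consec (xs ++ [ c ]) a b → a ∈ xs
  consec-∈ˡ []           (there ())
  consec-∈ˡ (x ∷ [])     here              = here refl
  consec-∈ˡ (x ∷ [])     (there (there ()))
  consec-∈ˡ (x ∷ y ∷ xs) here              = here refl
  consec-∈ˡ (x ∷ y ∷ xs) (there k)         = there (consec-∈ˡ (y ∷ xs) k)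

  consec-pred-unique : ∀ {x : A} {R a a′ b} → Unique R →
    Consec (x ∷ R) a b → Consec (x ∷ R) a′ b → a ≡ a′
  consec-pred-unique u        here      here       = refl
  consec-pred-unique (b∉ ∷ u) here      (there k)  = ⊥-elim (All.lookup b∉ (consec-∈ʳ k) refl)
  consec-pred-unique (b∉ ∷ u) (there k) here       = ⊥-elim (All.lookup b∉ (consec-∈ʳ k) refl)
  consec-pred-unique (_ ∷ u)  (there k) (there k′) = consec-pred-unique u k k′

  consec-succ-unique : ∀ (L : List A) {c a b b′} → Unique L →
    Consec (L ++ [ c ]) a b → Consec (L ++ [ c ]) a b′ → b ≡ b′
  consec-succ-unique []           u        (there ()) _
  consec-succ-unique (x ∷ [])     u        here       here                = refl
  consec-succ-unique (x ∷ [])     u        here       (there (there ()))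
  consec-succ-unique (x ∷ [])     u        (there (there ())) _
  consec-succ-unique (x ∷ y ∷ L)  u        here       here                = refl
  consec-succ-unique (x ∷ y ∷ L)  (a∉ ∷ u) here       (there k)           = ⊥-elim (All.lookup a∉ (consec-∈ˡ (y ∷ L) k) refl)
  consec-succ-unique (x ∷ y ∷ L)  (a∉ ∷ u) (there k)  here                = ⊥-elim (All.lookup a∉ (consec-∈ˡ (y ∷ L) k) refl)
  consec-succ-unique (x ∷ y ∷ L)  (_ ∷ u)  (there k)  (there k′)          = consec-succ-unique (y ∷ L) u k k′

  lastOf-∈ : ∀ (x : A) xs → lastOf x xs ∈ x ∷ xs
  lastOf-∈ x []       = here refl
  lastOf-∈ x (y ∷ xs) = there (lastOf-∈ y xs)

  lastOf-++ : ∀ (x : A) xs w ys → lastOf x (xs ++ w ∷ ys) ≡ lastOf w ys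
  lastOf-++ x []       w ys = refl
  lastOf-++ x (z ∷ xs) w ys = lastOf-++ z xs w ys

  lastOf-suffix : ∀ (x : A) l P₁ w P₂ → x ∷ l ≡ P₁ ++ w ∷ P₂ → lastOf x l ≡ lastOf w P₂
  lastOf-suffix x l []       w P₂ refl = refl
  lastOf-suffix x l (y ∷ P₁) w P₂ e with ∷-injective e
  ... | refl , refl = lastOf-++ x P₁ w P₂

  two≤length : ∀ (xs : List A) y zs → (xs ≡ [] → zs ≡ [] → ⊥) → 2 ≤ length (xs ++ y ∷ zs)
  two≤length []           y []      nonempty = ⊥-elim (nonempty refl refl)
  two≤length []           y (_ ∷ _) nonempty = s≤s (s≤s z≤n)
  two≤length (_ ∷ [])     y zs      nonempty = s≤s (s≤s z≤n)
  two≤length (_ ∷ _ ∷ xs) y zs      nonempty = s≤s (s≤s z≤n)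

  ++-∷-head : ∀ {q : A} {l} Q₁ {w Q₃} → q ∷ l ≡ Q₁ ++ w ∷ Q₃ → Σ (List A) λ rest → Q₁ ++ [ w ] ≡ q ∷ rest
  ++-∷-head []       e = [] , cong [_] (sym (proj₁ (∷-injective e)))
  ++-∷-head (_ ∷ Q₁) {w} e = Q₁ ++ [ w ] , cong (_∷ _) (sym (proj₁ (∷-injective e)))

  split-at-first-in : DecidableEquality A → ∀ (P Q : List A) {y} → y ∈ Q → y ∈ P →
    Σ (List A) λ Q₁ → Σ A λ w → Σ (List A) λ Q₃ → Q ≡ Q₁ ++ w ∷ Q₃ × All (_∉ P) Q₁ × w ∈ P
  split-at-first-in _≟_ P Q y∈Q y∈P =
    fromView (toView (¬All⇒First (λ x → ¬? (x ∈? P)) (decidable-stable (_ ∈? P)) λ all∉ → All.lookup all∉ y∈Q y∈P))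
    where
    open import Data.List.Membership.DecPropositional _≟_ using (_∈?_)
    fromView : ∀ {Q} → First.FirstView (_∉ P) (_∈ P) Q →
      Σ (List A) λ Q₁ → Σ A λ w → Σ (List A) λ Q₃ → Q ≡ Q₁ ++ w ∷ Q₃ × All (_∉ P) Q₁ × w ∈ P
    fromView (First._++_∷_ all∉ w∈ Q₃) = _ , _ , Q₃ , refl , all∉ , w∈

  cycle-neighbours : ∀ (c : A) cs {a b d} → Unique (c ∷ cs) →
    Consec (c ∷ cs ++ [ c ]) a b → Consec (c ∷ cs ++ [ c ]) b d →
    ∀ y → UEdge c cs y b → y ≡ a ⊎ y ≡ d
  cycle-neighbours c cs (c∉ ∷ u) ab bd y (inj₁ yb) =
    inj₁ (consec-pred-unique (++⁺ u ([] ∷ []) λ { (m , here refl) → All.lookup c∉ m refl }) yb ab)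
  cycle-neighbours c cs u ab bd y (inj₂ by) = inj₂ (consec-succ-unique (c ∷ cs) u by bd)

Walk : {A : Set} → (A → A → Set) → List A → Set
Walk R L = ∀ a b → Consec L a b → R a b

module _ {A : Set} {R : A → A → Set} where

  walk-tail : ∀ {x l} → Walk R (x ∷ l) → Walk R l
  walk-tail W a b k = W a b (there k)

  star-last-step : ∀ {x y} → Star R x y → x ≢ y → Σ A λ z → Star R x z × R z y
  star-last-step ε x≢x = ⊥-elim (x≢x refl)
  star-last-step (xj ◅ j⇝y) _ = last-of xj j⇝y
    where
    last-of : ∀ {x j y} → R x j → Star R j y → Σ A λ z → Star R x z × R z y
    last-of {x} xj ε = x , ε , xj
    last-of xj (jk ◅ k⇝y) with last-of jk k⇝y
    ... | z , j⇝z , zy = z , xj ◅ j⇝z , zy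

  star⇒walk : ∀ {x y} → Star R x y → Σ (List A) λ l → Walk R (x ∷ l) × lastOf x l ≡ y
  star⇒walk ε = [] , (λ { a b (there ()) }) , refl
  star⇒walk (_◅_ {j = j} r rs) with star⇒walk rs
  ... | l , W , last≡ = j ∷ l , W′ , last≡
    where
    W′ : Walk R (_ ∷ j ∷ l)
    W′ a b here      = r
    W′ a b (there k) = W a b k

  walk⇒star-from-head : ∀ {x l y} → Walk R (x ∷ l) → y ∈ x ∷ l → Star R x y
  walk⇒star-from-head W (here refl) = ε
  walk⇒star-from-head {l = j ∷ l} W (there m) = W _ j here ◅ walk⇒star-from-head (walk-tail W) m

  walk⇒star-to-last : ∀ {x l y} → Walk R (x ∷ l) → y ∈ x ∷ l → Star R y (lastOf x l)
  walk⇒star-to-last {l = []}    W (here refl) = ε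
  walk⇒star-to-last {l = j ∷ l} W (here refl) = W _ j here ◅ walk⇒star-to-last (walk-tail W) (here refl)
  walk⇒star-to-last {l = j ∷ l} W (there m)   = walk⇒star-to-last (walk-tail W) m

  walk-last-step : ∀ {w} l → Walk R (w ∷ l) →
    (Σ A λ x → R x (lastOf w l) × Consec (w ∷ l) x (lastOf w l)) ⊎ lastOf w l ≡ w
  walk-last-step []       W = inj₂ refl
  walk-last-step {w} (y ∷ l) W with consec-into-last w y l
  ... | x , k = inj₁ (x , W _ _ k , k)

  walk-head-fresh : (∀ a b → R a b → ¬ Star R b a) → ∀ {x l} → Walk R (x ∷ l) → x ∉ l
  walk-head-fresh acyc {x} {j ∷ l} W x∈ = acyc x j (W x j here) (walk⇒star-from-head (walk-tail W) x∈)

  walk-unique : (∀ a b → R a b → ¬ Star R b a) → ∀ {l} → Walk R l → Unique l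
  walk-unique acyc {[]}    W = []
  walk-unique acyc {x ∷ l} W =
    All.tabulate (λ y∈ x≡y → walk-head-fresh acyc W (subst (_∈ l) (sym x≡y) y∈)) ∷ walk-unique acyc (walk-tail W)

record CycleThrough (N : Graph) (p u q : Vtx N) : Set where
  field
    c       : Vtx N
    cs      : List (Vtx N)
    cycle   : IsUCycle N c cs
    p-u     : Consec (c ∷ cs ++ [ c ]) p u
    u-q     : Consec (c ∷ cs ++ [ c ]) u q
    p-entry : (Σ (Vtx N) λ x → Arc N x p × Consec (c ∷ cs ++ [ c ]) x p) ⊎ Reach N p q

module _ (N : Graph) (acyclic : Acyclic N) (r : Vtx N) (reach : ∀ u → Reach N r u) where

  private
    Arc⁻ : Vtx N → Vtx N → Set
    Arc⁻ = flip (Arc N)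

    Arc⁻-acyclic : ∀ a b → Arc⁻ a b → ¬ Star Arc⁻ b a
    Arc⁻-acyclic a b ba ab = acyclic b a ba (Star-reverse id ab)

  -- Follow a path r ⇝ p forward and a path r ⇝ q backward from q; the first vertex
  -- w of the backward one lying on the forward one closes the cycle
  -- w ⇝ p → u ← q ⇜ w.
  cycle-through : ∀ {p u q} → p ≢ q → Arc N p u → Arc N q u → CycleThrough N p u q
  cycle-through {p} {u} {q} p≢q pu qu
    with star⇒walk (reach p) | star⇒walk (Star-reverse id (reach q))
  ... | lp , WP , lastP | lq , WQ , lastQ
    with split-at-first-in _≟F_ (r ∷ lp) (q ∷ lq) (subst (_∈ q ∷ lq) lastQ (lastOf-∈ q lq)) (here refl)
  ... | Q₁ , w , Q₃ , eQ , Q₁∉P , w∈P with ∈-∃++ w∈P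
  ... | P₁ , P₂ , eP = record
    { c = w ; cs = P₂ ++ u ∷ Q₁ ; cycle = unique , long , adjacent
    ; p-u = to-cycle (subst (λ x → Consec L′ x u) lastP₂ (consec-junction w P₂ u (Q₁ ++ [ w ])))
    ; u-q = to-cycle (consec-++ʳ (w ∷ P₂) (subst (λ t → Consec (u ∷ t) u q) (sym (proj₂ second)) here))
    ; p-entry = p-entry }
    where
    WP₂ : Walk (Arc N) (w ∷ P₂)
    WP₂ a b k = WP a b (subst (λ L → Consec L a b) (sym eP) (consec-++ʳ P₁ k))
    lastP₂ : lastOf w P₂ ≡ p
    lastP₂ = trans (sym (lastOf-suffix r lp P₁ w P₂ eP)) lastP
    WuQ : Walk Arc⁻ (u ∷ q ∷ lq)
    WuQ a b here      = qu
    WuQ a b (there k) = WQ a b k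
    WuQ₁ : Walk Arc⁻ (u ∷ Q₁ ++ [ w ])
    WuQ₁ a b k = WuQ a b (subst (λ L → Consec L a b)
      (cong (u ∷_) (trans (++-assoc Q₁ [ w ] Q₃) (sym eQ))) (consec-++ˡ k))
    second : Σ (List (Vtx N)) λ rest → Q₁ ++ [ w ] ≡ q ∷ rest
    second = ++-∷-head Q₁ eQ
    w⇝q : Reach N w q
    w⇝q = Star-reverse id (walk⇒star-from-head WQ (subst (w ∈_) (sym eQ) (∈-++⁺ʳ Q₁ (here refl))))

    L′ : List (Vtx N)
    L′ = (w ∷ P₂) ++ (u ∷ Q₁ ++ [ w ])
    L≡L′ : w ∷ (P₂ ++ u ∷ Q₁) ++ [ w ] ≡ L′
    L≡L′ = cong (w ∷_) (++-assoc P₂ (u ∷ Q₁) [ w ])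
    to-cycle : ∀ {a b} → Consec L′ a b → Consec (w ∷ (P₂ ++ u ∷ Q₁) ++ [ w ]) a b
    to-cycle {a} {b} = subst (λ L → Consec L a b) (sym L≡L′)

    adjacent : ∀ a b → Consec (w ∷ (P₂ ++ u ∷ Q₁) ++ [ w ]) a b → Adj N a b
    adjacent a b k with consec-++⁻ w P₂ u (Q₁ ++ [ w ]) (subst (λ L → Consec L a b) L≡L′ k)
    ... | inj₁ k₁                  = inj₁ (WP₂ a b k₁)
    ... | inj₂ (inj₁ k₂)           = inj₂ (WuQ₁ a b k₂)
    ... | inj₂ (inj₂ (refl , refl)) = inj₁ (subst (λ x → Arc N x u) (sym lastP₂) pu)

    u∉P₂ : u ∉ w ∷ P₂
    u∉P₂ m = acyclic p u pu (subst (Reach N u) lastP₂ (walk⇒star-to-last WP₂ m))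
    disjoint : ∀ {y} → ¬ (y ∈ w ∷ P₂ × y ∈ u ∷ Q₁)
    disjoint (m , here refl) = u∉P₂ m
    disjoint (m , there m′)  = All.lookup Q₁∉P m′ (subst (_ ∈_) (sym eP) (∈-++⁺ʳ P₁ m))
    unique : Unique (w ∷ P₂ ++ u ∷ Q₁)
    unique = ++⁺ (walk-unique acyclic WP₂) (walk-unique Arc⁻-acyclic λ a b k → WuQ₁ a b (consec-++ˡ k)) disjoint

    long : 2 ≤ length (P₂ ++ u ∷ Q₁)
    long = two≤length P₂ u Q₁ λ P₂≡[] Q₁≡[] →
      p≢q (trans (sym lastP₂) (trans (cong (lastOf w) P₂≡[])
                 (sym (proj₁ (∷-injective (trans eQ (cong (_++ w ∷ Q₃) Q₁≡[])))))))

    p-entry : (Σ (Vtx N) λ x → Arc N x p × Consec (w ∷ (P₂ ++ u ∷ Q₁) ++ [ w ]) x p) ⊎ Reach N p q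
    p-entry with walk-last-step P₂ WP₂
    ... | inj₁ (x , xp , k) =
      inj₁ (x , subst (Arc N x) lastP₂ xp , to-cycle (consec-++ˡ (subst (Consec (w ∷ P₂) x) lastP₂ k)))
    ... | inj₂ last≡w = inj₂ (subst (λ t → Reach N t q) (trans (sym last≡w) lastP₂) w⇝q)

-- Local structure of a rooted cactus

module _ {N : Graph} (acyclic : Acyclic N) where

  -- the only way out of a vertex of outdegree one is its child, which q points into
  unary-not-above-coparent : ∀ {a b q} → outdeg N a ≡ 1 → Arc N a b → Arc N q b → q ≢ a → ¬ Reach N a q
  unary-not-above-coparent o ab qb q≢a ε = q≢a refl
  unary-not-above-coparent {a} o ab qb q≢a (az ◅ z⇝q)
    with countB≡1 (λ z → arc N a z) o ab az
  ... | refl = acyclic _ _ qb z⇝q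

module _ {N : Graph} (cactusN : RootedCactus N) where
  open RootedCactus cactusN
  open CycleThrough

  private
    cycle-at : ∀ {p u q} → p ≢ q → Arc N p u → Arc N q u → CycleThrough N p u q
    cycle-at = cycle-through N acyclic root (proj₂ (proj₂ isRoot))

    transfer-edge : ∀ {c₁ cs₁ c₂ cs₂ x a y} → IsUCycle N c₁ cs₁ → IsUCycle N c₂ cs₂ →
      Consec (c₁ ∷ cs₁ ++ [ c₁ ]) x a → Consec (c₂ ∷ cs₂ ++ [ c₂ ]) x a →
      UEdge c₁ cs₁ y a → UEdge c₂ cs₂ y a
    transfer-edge X Y k₁ k₂ = Equivalence.to (cactus _ _ _ _ X Y (_ , _ , inj₁ k₁ , inj₁ k₂) _ _)

    another-parent : ∀ {b x} → indeg N b ≡ 2 → Arc N x b → Σ (Vtx N) λ y → Arc N y b × y ≢ x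
    another-parent = countB-another (λ a → arc N a _)

  -- The cycles closed by p₁ u p₂ and by p₁ u p₃ share the edge p₁u, hence coincide.
  no-three-parents : ∀ {u p₁ p₂ p₃} → p₁ ≢ p₂ → p₁ ≢ p₃ → p₂ ≢ p₃ →
    Arc N p₁ u → Arc N p₂ u → Arc N p₃ u → ⊥
  no-three-parents p₁≢p₂ p₁≢p₃ p₂≢p₃ a₁ a₂ a₃
    with cycle-neighbours (c Y) (cs Y) (proj₁ (cycle Y)) (p-u Y) (u-q Y) _
           (transfer-edge (cycle X) (cycle Y) (p-u X) (p-u Y) (inj₂ (u-q X)))
    where
    X = cycle-at p₁≢p₂ a₁ a₂
    Y = cycle-at p₁≢p₃ a₁ a₃
  ... | inj₁ p₂≡p₁ = p₁≢p₂ (sym p₂≡p₁)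
  ... | inj₂ p₂≡p₃ = p₂≢p₃ p₂≡p₃

  cactus-indeg-1-or-2 : ∀ u → u ≢ root → indeg N u ≡ 1 ⊎ indeg N u ≡ 2
  cactus-indeg-1-or-2 u u≢root with indeg N u in d
  ... | zero = ⊥-elim (u≢root (proj₁ (proj₂ isRoot) u d))
  ... | suc zero = inj₁ refl
  ... | suc (suc zero) = inj₂ refl
  ... | suc (suc (suc k)) with countB-three (λ a → arc N a u) d
  ...   | x₁ , x₂ , x₃ , x₁≢x₂ , x₁≢x₃ , x₂≢x₃ , a₁ , a₂ , a₃ = ⊥-elim (no-three-parents x₁≢x₂ x₁≢x₃ x₂≢x₃ a₁ a₂ a₃)

  -- Let a → b with a a reticulation of outdegree one and b a reticulation with another
  -- parent q.  Since a cannot reach q, on the cycle closed by a b q the vertex a is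
  -- entered by an arc x → a; the cycle closed by x a y (y the other parent of a) shares
  -- the edge xa with it, so y is a neighbour of a there, i.e. y ∈ {x, b}: impossible.
  no-reticulation-below-unary-reticulation : ∀ {a b} → indeg N a ≡ 2 → outdeg N a ≡ 1 →
    Arc N a b → indeg N b ≢ 2
  no-reticulation-below-unary-reticulation ia oa ab ib with another-parent ib ab
  ... | q , qb , q≢a with p-entry Y
    where
    Y = cycle-at (q≢a ∘ sym) ab qb
  ... | inj₂ a⇝q = unary-not-above-coparent acyclic oa ab qb q≢a a⇝q
  ... | inj₁ (x , xa , x-a) with another-parent ia xa
  ... | y , ya , y≢x
    with cycle-neighbours (c Y) (cs Y) (proj₁ (cycle Y)) x-a (p-u Y) y
           (transfer-edge (cycle X) (cycle Y) (p-u X) x-a (inj₂ (u-q X)))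
    where
    Y = cycle-at (q≢a ∘ sym) ab qb
    X = cycle-at (y≢x ∘ sym) xa ya
  ... | inj₁ y≡x = y≢x y≡x
  ... | inj₂ refl = acyclic _ _ ab (ya ◅ ε)

-- The invariant of the unfolding

LabelFits : Maybe Label → ℕ → Set
LabelFits nothing   k = ⊤
LabelFits (just lx) k = ⊥
LabelFits (just ly) k = ⊥
LabelFits (just lr) k = k ≡ 0
LabelFits (just lz) k = k ≢ 0
LabelFits (just ls) k = k ≢ 0 × k ≢ 1

-- Holds after step (A), is preserved by every step (B), and once no reticulation is
-- left it makes step (C) produce a special pair.
record PreSpecial (g : Graph) (l : Vtx g → Maybe Label) : Set where
  field
    acyclic      : Acyclic g
    root         : Vtx g
    root-indeg   : indeg g root ≡ 0
    indeg-1-or-2 : ∀ u → u ≢ root → indeg g u ≡ 1 ⊎ indeg g u ≡ 2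
    reach        : ∀ u → Reach g root u
    label-fits   : ∀ u → LabelFits (l u) (outdeg g u)
    below-unary  : ∀ p u → Arc g p u → outdeg g p ≡ 1 → indeg g u ≢ 2 × l u ≢ just lz

module _ {g : Graph} {l : Vtx g → Maybe Label} (inv : PreSpecial g l) where
  open PreSpecial inv

  only-root-reaches-root : ∀ {x} → Reach g x root → x ≡ root
  only-root-reaches-root ε = refl
  only-root-reaches-root (xy ◅ y⇝root) = ⊥-elim (acyclic _ _ xy (y⇝root ◅◅ reach _))

  private
    lab : Vtx g → Label
    lab = VLGraph.tlab (stepC (mkLG g l))

    lab-just : ∀ u {k} → l u ≡ just k → lab u ≡ k
    lab-just u e rewrite e = refl

    unary-label : ∀ u → outdeg g u ≡ 1 → l u ≡ just lz ⊎ lab u ≡ ly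
    unary-label u o with l u | label-fits u
    ... | nothing | _ rewrite o = inj₂ refl
    ... | just lz | _ = inj₁ refl
    ... | just lr | fits with trans (sym o) fits
    ...   | ()
    unary-label u o | just ls | fits = ⊥-elim (proj₂ fits o)

    string-tail : ∀ a ws → outdeg g a ≡ 1 → All (λ u → outdeg g u ≡ 1) ws →
      Walk (Arc g) (a ∷ ws) → All (λ u → lab u ≡ ly) ws
    string-tail a []       _  _        _ = []
    string-tail a (b ∷ ws) oa (ob ∷ os) W with unary-label b ob
    ... | inj₁ z = ⊥-elim (proj₂ (below-unary a b (W a b here) oa) z)
    ... | inj₂ y = y ∷ string-tail b ws ob os (walk-tail W)

  special-of-preSpecial : (∀ u → indeg g u ≢ 2) → Special (stepC (mkLG g l))
  special-of-preSpecial no-reticulation = tree , leaves , strings , others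
    where
    tree : RootedTree g
    tree = root , root-indeg , indeg-1 , reach
      where
      indeg-1 : ∀ u → u ≢ root → indeg g u ≡ 1
      indeg-1 u u≢root with indeg-1-or-2 u u≢root
      ... | inj₁ i = i
      ... | inj₂ i = ⊥-elim (no-reticulation u i)

    leaves : ∀ u → outdeg g u ≡ 0 → lab u ≡ lx ⊎ lab u ≡ lr
    leaves u o with l u | label-fits u
    ... | nothing | _ rewrite o = inj₁ refl
    ... | just lr | _    = inj₂ refl
    ... | just lz | fits = ⊥-elim (fits o)
    ... | just ls | fits = ⊥-elim (proj₁ fits o)

    strings : ∀ w ws → IsString g w ws → (lab w ≡ ly ⊎ lab w ≡ lz) × All (λ u → lab u ≡ ly) ws
    strings w ws (W , (ow ∷ os) , _ , _) with unary-label w ow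
    ... | inj₁ z = inj₂ (lab-just w z) , string-tail w ws ow os W
    ... | inj₂ y = inj₁ y , string-tail w ws ow os W

    others : ∀ u → outdeg g u ≢ 0 → ¬ InString g u → lab u ≡ ly ⊎ lab u ≡ lz ⊎ lab u ≡ ls
    others u o _ with l u | label-fits u
    ... | nothing | _ with outdeg g u
    ...   | zero  = ⊥-elim (o refl)
    ...   | suc _ = inj₁ refl
    others u o _ | just lr | fits = ⊥-elim (o fits)
    others u o _ | just lz | _    = inj₂ (inj₁ refl)
    others u o _ | just ls | _    = inj₂ (inj₂ refl)

-- Step (B)

data Extension (n m : ℕ) : Fin (n + m) → Set where
  old : (a : Fin n) → Extension n m (a ↑ˡ m)
  new : (j : Fin m) → Extension n m (n ↑ʳ j)

extension : ∀ n {m} (x : Fin (n + m)) → Extension n m x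
extension n x with splitAt n x in e
... | inj₁ a = subst (Extension n _) (splitAt⁻¹-↑ˡ e) (old a)
... | inj₂ j = subst (Extension n _) (splitAt⁻¹-↑ʳ e) (new j)

module BStep {g : Graph} {l : Vtx g → Maybe Label}
             (inv : PreSpecial g l) (ch : ChoiceB (mkLG g l)) where
  open PreSpecial inv
  open ChoiceB ch

  private
    n : ℕ
    n = size g
    g′ : Graph
    g′ = LGraph.lgraph (buildB (mkLG g l) ch)
    l′ : Vtx g′ → Maybe Label
    l′ = LGraph.llab (buildB (mkLG g l) ch)
    O : Vtx g → Vtx g′
    O a = a ↑ˡ d
    C : Fin d → Vtx g′
    C j = n ↑ʳ j
    rz′ : Label
    rz′ = rz (mkLG g l) ch

  collapse : Vtx g′ → Vtx g
  collapse x = [ id , D ]′ (splitAt n x)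

  private
    collapse-O : ∀ a → collapse (O a) ≡ a
    collapse-O a rewrite splitAt-↑ˡ n a d = refl
    collapse-C : ∀ j → collapse (C j) ≡ D j
    collapse-C j rewrite splitAt-↑ʳ n d j = refl

    arc-OO : ∀ a b → arc g′ (O a) (O b) ≡ (arc g a b ∧ not (eqF a w ∧ eqF b v))
    arc-OO a b rewrite splitAt-↑ˡ n a d | splitAt-↑ˡ n b d = refl
    arc-OC : ∀ a j → arc g′ (O a) (C j) ≡ (eqF a w ∧ eqF j iv)
    arc-OC a j rewrite splitAt-↑ˡ n a d | splitAt-↑ʳ n d j = refl
    arc-CO : ∀ i b → arc g′ (C i) (O b) ≡ false
    arc-CO i b rewrite splitAt-↑ʳ n d i | splitAt-↑ˡ n b d = refl
    arc-CC : ∀ i j → arc g′ (C i) (C j) ≡ arc g (D i) (D j)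
    arc-CC i j rewrite splitAt-↑ʳ n d i | splitAt-↑ʳ n d j = refl

    label-O : ∀ a → l′ (O a) ≡ (if eqF a v then just rz′ else l a)
    label-O a rewrite splitAt-↑ˡ n a d = refl
    label-C : ∀ j → l′ (C j) ≡ (if eqF j iv then just rz′ else l (D j))
    label-C j rewrite splitAt-↑ʳ n d j = refl

    w→Civ : Arc g′ (O w) (C iv)
    w→Civ rewrite arc-OC w iv | eqF-refl w | eqF-refl iv = refl

    w↛Ov : arc g′ (O w) (O v) ≡ false
    w↛Ov rewrite arc-OO w v | eqF-refl w | eqF-refl v = ∧-zeroʳ (arc g w v)

    C↛O : ∀ i b → ¬ Arc g′ (C i) (O b)
    C↛O i b = false⇒¬true (arc-CO i b)

    kept-arc : ∀ {a b} → Arc g a b → ¬ (a ≡ w × b ≡ v) → Arc g′ (O a) (O b)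
    kept-arc {a} {b} ab not-wv rewrite arc-OO a b | ab with eqF a w in aw | eqF b v in bv
    ... | true  | true  = ⊥-elim (not-wv (eqF-true aw , eqF-true bv))
    ... | true  | false = refl
    ... | false | _     = refl

    copy-of-descendant : ∀ {u} → Reach g v u → Σ (Fin d) λ j → D j ≡ u
    copy-of-descendant = Equivalence.to (D-desc _)
    descendant-copy : ∀ j → Reach g v (D j)
    descendant-copy j = Equivalence.from (D-desc (D j)) (j , refl)

    D≢v : ∀ {j} → j ≢ iv → D j ≢ v
    D≢v j≢iv e = j≢iv (D-inj (trans e (sym D-iv)))

    eqF-iv : ∀ j → eqF j iv ≡ eqF (D j) v
    eqF-iv j with j ≟F iv
    ... | yes refl = sym (trans (cong (λ t → eqF t v) D-iv) (eqF-refl v))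
    ... | no j≢iv  = sym (eqF-≢ (D≢v j≢iv))

    v≢root : v ≢ root
    v≢root v≡root with trans (sym retic) (trans (cong (indeg g) v≡root) root-indeg)
    ... | ()

    child-copy : ∀ {i b} → Arc g (D i) b → Σ (Fin d) λ k → D k ≡ b
    child-copy {i} ab = copy-of-descendant (descendant-copy i ◅◅ (ab ◅ ε))

    -- below the lowest reticulation v every vertex has a single parent, a descendant of v
    parent-copy : ∀ {j a} → j ≢ iv → Arc g a (D j) → Σ (Fin d) λ k → D k ≡ a
    parent-copy {j} {a} j≢iv aD with descendant-copy j
    ... | ε = ⊥-elim (D≢v j≢iv refl)
    ... | vx ◅ x⇝D with star-last-step (vx ◅ x⇝D) (D≢v j≢iv ∘ sym)
    ...   | z , v⇝z , zD = subst (λ t → Σ (Fin d) λ k → D k ≡ t) (countB≡1 (λ t → arc g t (D j)) single aD zD)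
                                 (copy-of-descendant v⇝z)
      where
      single : indeg g (D j) ≡ 1
      single with indeg-1-or-2 (D j) (λ D≡root → v≢root (only-root-reaches-root inv (subst (Reach g v) D≡root (descendant-copy j))))
      ... | inj₁ one = one
      ... | inj₂ two = ⊥-elim (lowest _ (D j) vx x⇝D two)

  collapse-arc : ∀ x y → Arc g′ x y → Arc g (collapse x) (collapse y)
  collapse-arc x y xy with extension n x | extension n y
  ... | old a | old b rewrite collapse-O a | collapse-O b | arc-OO a b = ∧-conicalˡ _ _ xy
  ... | old a | new j rewrite collapse-O a | collapse-C j | arc-OC a j
    with eqF-true {a = a} (∧-conicalˡ _ _ xy) | eqF-true {a = j} (∧-conicalʳ _ _ xy)
  ...   | refl | refl rewrite D-iv = parent
  collapse-arc x y xy | new i | old b = ⊥-elim (C↛O i b xy)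
  collapse-arc x y xy | new i | new j rewrite collapse-C i | collapse-C j | arc-CC i j = xy

  collapse-reach : ∀ {x y} → Reach g′ x y → Reach g (collapse x) (collapse y)
  collapse-reach ε         = ε
  collapse-reach (xy ◅ y⇝) = collapse-arc _ _ xy ◅ collapse-reach y⇝

  acyclic′ : Acyclic g′
  acyclic′ x y xy y⇝x = acyclic _ _ (collapse-arc x y xy) (collapse-reach y⇝x)

  private
    out-not-mixed : ∀ x b j → Arc g′ x (O b) → Arc g′ x (C j) → b ≢ D j
    out-not-mixed x b j xb xj with extension n x
    ... | new i = ⊥-elim (C↛O i b xb)
    out-not-mixed x b j xb xj | old a rewrite arc-OC a j
      with eqF-true {a = a} (∧-conicalˡ _ _ xj) | eqF-true {a = j} (∧-conicalʳ _ _ xj)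
    ... | refl | refl = λ b≡Div → false⇒¬true w↛Ov (subst (λ t → Arc g′ (O w) (O t)) (trans b≡Div D-iv) xb)

  outdeg-collapse : ∀ x → outdeg g′ x ≡ outdeg g (collapse x)
  outdeg-collapse x = countB-bij (arc g′ x) (arc g (collapse x)) collapse (collapse-arc x) injective onto
    where
    injective : ∀ y₁ y₂ → Arc g′ x y₁ → Arc g′ x y₂ → collapse y₁ ≡ collapse y₂ → y₁ ≡ y₂
    injective y₁ y₂ xy₁ xy₂ e with extension n y₁ | extension n y₂
    ... | old a | old b rewrite collapse-O a | collapse-O b = cong O e
    ... | new i | new j rewrite collapse-C i | collapse-C j = cong C (D-inj e)
    ... | old a | new j rewrite collapse-O a | collapse-C j = ⊥-elim (out-not-mixed x a j xy₁ xy₂ e)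
    ... | new i | old b rewrite collapse-C i | collapse-O b = ⊥-elim (out-not-mixed x b i xy₂ xy₁ (sym e))
    onto : ∀ b → Arc g (collapse x) b → Σ (Vtx g′) λ y → Arc g′ x y × collapse y ≡ b
    onto b xb with extension n x
    ... | new i rewrite collapse-C i with child-copy xb
    ...   | k , refl = C k , trans (arc-CC i k) xb , collapse-C k
    onto b xb | old a rewrite collapse-O a with a ≟F w | b ≟F v
    ... | yes refl | yes refl = C iv , w→Civ , trans (collapse-C iv) D-iv
    ... | yes refl | no b≢v   = O b , kept-arc xb (b≢v ∘ proj₂) , collapse-O b
    ... | no a≢w   | _        = O b , kept-arc xb (a≢w ∘ proj₁) , collapse-O b

  private
    indeg-O : ∀ {b} → b ≢ v → indeg g′ (O b) ≡ indeg g b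
    indeg-O {b} b≢v = countB-bij (λ y → arc g′ y (O b)) (λ a → arc g a b) collapse maps injective onto
      where
      maps : ∀ y → Arc g′ y (O b) → Arc g (collapse y) b
      maps y yb = subst (Arc g (collapse y)) (collapse-O b) (collapse-arc y (O b) yb)
      injective : ∀ y₁ y₂ → Arc g′ y₁ (O b) → Arc g′ y₂ (O b) → collapse y₁ ≡ collapse y₂ → y₁ ≡ y₂
      injective y₁ y₂ y₁b y₂b e with extension n y₁ | extension n y₂
      ... | old a | old c rewrite collapse-O a | collapse-O c = cong O e
      ... | new i | _     = ⊥-elim (C↛O i b y₁b)
      ... | _     | new i = ⊥-elim (C↛O i b y₂b)
      onto : ∀ a → Arc g a b → Σ (Vtx g′) λ y → Arc g′ y (O b) × collapse y ≡ a
      onto a ab = O a , kept-arc ab (b≢v ∘ proj₂) , collapse-O a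

    -- the arc w → v was redirected to the copy of v
    indeg-Ov : indeg g′ (O v) ≡ 1
    indeg-Ov = trans (countB-bij (λ y → arc g′ y (O v)) (P without w) collapse maps injective onto)
                     (suc-injective (trans (sym (countB-without P w parent)) retic))
      where
      P : Vtx g → Bool
      P a = arc g a v
      maps : ∀ y → Arc g′ y (O v) → (P without w) (collapse y) ≡ true
      maps y yv with extension n y
      ... | new i = ⊥-elim (C↛O i v yv)
      ... | old a rewrite collapse-O a =
        without-intro P (∧-conicalˡ _ _ (trans (sym (arc-OO a v)) yv))
                        λ { refl → false⇒¬true w↛Ov yv }
      injective : ∀ y₁ y₂ → Arc g′ y₁ (O v) → Arc g′ y₂ (O v) → collapse y₁ ≡ collapse y₂ → y₁ ≡ y₂
      injective y₁ y₂ y₁v y₂v e with extension n y₁ | extension n y₂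
      ... | old a | old c rewrite collapse-O a | collapse-O c = cong O e
      ... | new i | _     = ⊥-elim (C↛O i v y₁v)
      ... | _     | new i = ⊥-elim (C↛O i v y₂v)
      onto : ∀ a → (P without w) a ≡ true → Σ (Vtx g′) λ y → Arc g′ y (O v) × collapse y ≡ a
      onto a e with without-true P w a e
      ... | av , a≢w = O a , kept-arc av (a≢w ∘ proj₁) , collapse-O a

    indeg-Civ : indeg g′ (C iv) ≡ 1
    indeg-Civ = countB-one (λ y → arc g′ y (C iv)) (O w) w→Civ only-w
      where
      only-w : ∀ y → Arc g′ y (C iv) → y ≡ O w
      only-w y yc with extension n y
      ... | old a rewrite arc-OC a iv = cong O (eqF-true (∧-conicalˡ _ _ yc))
      ... | new i rewrite arc-CC i iv | D-iv = ⊥-elim (acyclic _ _ yc (descendant-copy i))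

    indeg-C : ∀ {j} → j ≢ iv → indeg g′ (C j) ≡ indeg g (D j)
    indeg-C {j} j≢iv = countB-bij (λ y → arc g′ y (C j)) (λ a → arc g a (D j)) collapse maps injective onto
      where
      O↛C : ∀ a → ¬ Arc g′ (O a) (C j)
      O↛C a rewrite arc-OC a j | eqF-≢ j≢iv = false⇒¬true (∧-zeroʳ (eqF a w))
      maps : ∀ y → Arc g′ y (C j) → Arc g (collapse y) (D j)
      maps y yc = subst (Arc g (collapse y)) (collapse-C j) (collapse-arc y (C j) yc)
      injective : ∀ y₁ y₂ → Arc g′ y₁ (C j) → Arc g′ y₂ (C j) → collapse y₁ ≡ collapse y₂ → y₁ ≡ y₂
      injective y₁ y₂ y₁c y₂c e with extension n y₁ | extension n y₂
      ... | new i | new k rewrite collapse-C i | collapse-C k = cong C (D-inj e)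
      ... | old a | _     = ⊥-elim (O↛C a y₁c)
      ... | _     | old a = ⊥-elim (O↛C a y₂c)
      onto : ∀ a → Arc g a (D j) → Σ (Vtx g′) λ y → Arc g′ y (C j) × collapse y ≡ a
      onto a aD with parent-copy j≢iv aD
      ... | k , refl = C k , trans (arc-CC k j) aD , collapse-C k

  indeg-at-v : ∀ x → collapse x ≡ v → indeg g′ x ≡ 1
  indeg-at-v x cx with extension n x
  ... | old a rewrite collapse-O a | cx = indeg-Ov
  ... | new j rewrite collapse-C j with j ≟F iv
  ...   | yes refl   = indeg-Civ
  ...   | no j≢iv    = ⊥-elim (D≢v j≢iv cx)

  indeg-off-v : ∀ x → collapse x ≢ v → indeg g′ x ≡ indeg g (collapse x)
  indeg-off-v x cx with extension n x
  ... | old a rewrite collapse-O a = indeg-O cx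
  ... | new j rewrite collapse-C j with j ≟F iv
  ...   | yes refl   = ⊥-elim (cx D-iv)
  ...   | no j≢iv    = indeg-C j≢iv

  private
    avoiding-v : ∀ {x y} → Reach g x y → ¬ Reach g v y → Reach g′ (O x) (O y)
    avoiding-v ε         _   = ε
    avoiding-v (xz ◅ z⇝y) v↛y =
      kept-arc xz (λ wv → v↛y (subst (λ t → Reach g t _) (proj₂ wv) z⇝y)) ◅ avoiding-v z⇝y v↛y

    -- through the parent of v other than w
    Ov-reachable : Reach g′ (O root) (O v)
    Ov-reachable with countB-another (λ a → arc g a v) retic parent
    ... | p , pv , p≢w = avoiding-v (reach p) (acyclic p v pv) ◅◅ (kept-arc pv (p≢w ∘ proj₁) ◅ ε)

    old-reachable : ∀ {x y} → Reach g x y → Reach g′ (O root) (O x) → Reach g′ (O root) (O y)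
    old-reachable ε Ox-reachable = Ox-reachable
    old-reachable {x} (_◅_ {j = z} xz z⇝y) Ox-reachable with (x ≟F w) ×-dec (z ≟F v)
    ... | yes (refl , refl) = old-reachable z⇝y Ov-reachable
    ... | no not-wv         = old-reachable z⇝y (Ox-reachable ◅◅ (kept-arc xz not-wv ◅ ε))

    copy-reachable : ∀ {i y} → Reach g (D i) y → Σ (Fin d) λ k → D k ≡ y × Reach g′ (C i) (C k)
    copy-reachable {i} ε = i , refl , ε
    copy-reachable {i} (Dz ◅ z⇝y) with child-copy Dz
    ... | k , refl with copy-reachable z⇝y
    ...   | m , Dm≡y , Ck⇝Cm = m , Dm≡y , (trans (arc-CC i k) Dz ◅ Ck⇝Cm)

  reach′ : ∀ x → Reach g′ (O root) x
  reach′ x with extension n x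
  ... | old a = old-reachable (reach a) ε
  ... | new j with copy-reachable {iv} (subst (λ t → Reach g t (D j)) (sym D-iv) (descendant-copy j))
  ...   | k , Dk≡Dj , Civ⇝Ck with D-inj Dk≡Dj
  ...     | refl = old-reachable (reach w) ε ◅◅ (w→Civ ◅ Civ⇝Ck)

  label-collapse : ∀ x → l′ x ≡ (if eqF (collapse x) v then just rz′ else l (collapse x))
  label-collapse x with extension n x
  ... | old a rewrite collapse-O a = label-O a
  ... | new j rewrite collapse-C j | label-C j | eqF-iv j = refl

  private
    rz-fits : LabelFits (just rz′) (outdeg g v)
    rz-fits with outdeg g v
    ... | zero  = refl
    ... | suc _ = λ ()

    collapse≢root : ∀ {x} → x ≢ O root → collapse x ≢ root
    collapse≢root {x} x≢Oroot with extension n x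
    ... | old a rewrite collapse-O a = λ a≡root → x≢Oroot (cong O a≡root)
    ... | new j rewrite collapse-C j = λ D≡root →
      v≢root (only-root-reaches-root inv (subst (Reach g v) D≡root (descendant-copy j)))

  preSpecial′ : PreSpecial g′ l′
  preSpecial′ = record
    { acyclic      = acyclic′
    ; root         = O root
    ; root-indeg   = trans (indeg-off-v (O root) (λ e → v≢root (trans (sym e) (collapse-O root))))
                           (trans (cong (indeg g) (collapse-O root)) root-indeg)
    ; indeg-1-or-2 = indeg-1-or-2′
    ; reach        = reach′
    ; label-fits   = label-fits′
    ; below-unary  = below-unary′
    }
    where
    indeg-1-or-2′ : ∀ x → x ≢ O root → indeg g′ x ≡ 1 ⊎ indeg g′ x ≡ 2
    indeg-1-or-2′ x x≢Oroot with collapse x ≟F v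
    ... | yes cx = inj₁ (indeg-at-v x cx)
    ... | no cx rewrite indeg-off-v x cx = indeg-1-or-2 (collapse x) (collapse≢root x≢Oroot)

    label-fits′ : ∀ x → LabelFits (l′ x) (outdeg g′ x)
    label-fits′ x rewrite label-collapse x | outdeg-collapse x with eqF (collapse x) v in cx
    ... | true  = subst (λ t → LabelFits (just rz′) (outdeg g t)) (sym (eqF-true cx)) rz-fits
    ... | false = label-fits (collapse x)

    below-unary′ : ∀ p u → Arc g′ p u → outdeg g′ p ≡ 1 → indeg g′ u ≢ 2 × l′ u ≢ just lz
    below-unary′ p u pu o
      with below-unary (collapse p) (collapse u) (collapse-arc p u pu) (trans (sym (outdeg-collapse p)) o)
    ... | not-reticulation , not-z = not-reticulation′ , not-z′
      where
      cu≢v : collapse u ≢ v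
      cu≢v cu≡v = not-reticulation (trans (cong (indeg g) cu≡v) retic)
      not-reticulation′ : indeg g′ u ≢ 2
      not-reticulation′ two = not-reticulation (trans (sym (indeg-off-v u cu≢v)) two)
      not-z′ : l′ u ≢ just lz
      not-z′ rewrite label-collapse u | eqF-≢ cu≢v = not-z

preSpecial-run : ∀ {G H} → PreSpecial (LGraph.lgraph G) (LGraph.llab G) → BRun G H →
  PreSpecial (LGraph.lgraph H) (LGraph.llab H) × (∀ u → indeg (LGraph.lgraph H) u ≢ 2)
preSpecial-run inv (done no-reticulation) = inv , no-reticulation
preSpecial-run inv (step (stepB ch) run)  = preSpecial-run (BStep.preSpecial′ inv ch) run

-- Step (A)

module AStep {N : Graph} (cactusN : RootedCactus N) (no-elementary : NoElementary N) (ch : ChoiceA N) where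
  open RootedCactus cactusN
  open ChoiceA ch

  private
    n : ℕ
    n = size N
    g₀ : Graph
    g₀ = LGraph.lgraph (buildA N ch)
    l₀ : Vtx g₀ → Maybe Label
    l₀ = LGraph.llab (buildA N ch)
    O : Vtx N → Vtx g₀
    O a = a ↑ˡ m
    S : Fin m → Vtx g₀
    S j = n ↑ʳ j

    -- the i-th new vertex sits between the top v i and the children w i, w′ i
    v w w′ : Fin m → Vtx N
    v i  = top (t i)
    w i  = c₁ (t i)
    w′ i = c₂ (t i)

    IsChild : Fin m → Vtx N → Set
    IsChild i b = w i ≡ b ⊎ w′ i ≡ b

    first-arc : ∀ {G a I b} → DPath G a I b → Arc G a (firstStep I b)
    first-arc (arcP ab)   = ab
    first-arc (consP ab _) = ab

    top-child : ∀ i {b} → IsChild i b → Arc N (v i) b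
    top-child i child with sound i
    ... | _ , _ , _ , (_ , path₁ , path₂ , _) , first₁ , first₂ with child
    ...   | inj₁ refl = subst (Arc N (v i)) first₁ (first-arc path₁)
    ...   | inj₂ refl = subst (Arc N (v i)) first₂ (first-arc path₂)

    w≢w′ : ∀ i → w i ≢ w′ i
    w≢w′ i e with distinct {i , false} {i , true} (cong (v i ,_) e)
    ... | ()

    side : ∀ {i b} → IsChild i b → Bool
    side (inj₁ _) = false
    side (inj₂ _) = true

    side-child : ∀ {i b} (child : IsChild i b) → (if side child then w′ i else w i) ≡ b
    side-child (inj₁ e) = e
    side-child (inj₂ e) = e

    -- the arcs v i → w i, v i → w′ i are pairwise distinct, so each lies under one new vertex
    same-new-vertex : ∀ i j {b} → v i ≡ v j → IsChild i b → IsChild j b → i ≡ j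
    same-new-vertex i j vv ci cj =
      cong proj₁ (distinct {i , side ci} {j , side cj} (cong₂ _,_ vv (trans (side-child ci) (sym (side-child cj)))))

    child⁻ : ∀ i b → (eqF (w i) b ∨ eqF (w′ i) b) ≡ true → IsChild i b
    child⁻ i b e with eqF (w i) b in wb
    ... | true  = inj₁ (eqF-true wb)
    ... | false = inj₂ (eqF-true e)

    child⁺ : ∀ i b → IsChild i b → (eqF (w i) b ∨ eqF (w′ i) b) ≡ true
    child⁺ i b (inj₁ refl) rewrite eqF-refl (w i) = refl
    child⁺ i b (inj₂ refl) rewrite eqF-refl (w′ i) with eqF (w i) (w′ i)
    ... | true  = refl
    ... | false = refl

    rerouted : Vtx N → Vtx N → Bool
    rerouted a b = anyFin (λ i → eqF (v i) a ∧ (eqF (w i) b ∨ eqF (w′ i) b))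

    rerouted⁻ : ∀ a b → rerouted a b ≡ true → Σ (Fin m) λ i → v i ≡ a × IsChild i b
    rerouted⁻ a b e with anyFin-true _ e
    ... | i , hit = i , eqF-true (∧-conicalˡ _ _ hit) , child⁻ i b (∧-conicalʳ _ _ hit)

    rerouted⁺ : ∀ i b → IsChild i b → rerouted (v i) b ≡ true
    rerouted⁺ i b child = anyFin-intro _ i (cong₂ _∧_ (eqF-refl (v i)) (child⁺ i b child))

  project : Vtx g₀ → Vtx N
  project x = [ id , v ]′ (splitAt n x)

  private
    project-O : ∀ a → project (O a) ≡ a
    project-O a rewrite splitAt-↑ˡ n a m = refl
    project-S : ∀ j → project (S j) ≡ v j
    project-S j rewrite splitAt-↑ʳ n m j = refl

    O-injective : ∀ {a b} → O a ≡ O b → a ≡ b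
    O-injective {a} {b} e = trans (sym (project-O a)) (trans (cong project e) (project-O b))

    O≢S : ∀ a j → O a ≢ S j
    O≢S a j e with trans (sym (splitAt-↑ˡ n a m)) (trans (cong (splitAt n) e) (splitAt-↑ʳ n m j))
    ... | ()

    arc-OO : ∀ a b → arc g₀ (O a) (O b) ≡ (arc N a b ∧ not (rerouted a b))
    arc-OO a b rewrite splitAt-↑ˡ n a m | splitAt-↑ˡ n b m = refl
    arc-OS : ∀ a j → arc g₀ (O a) (S j) ≡ eqF (v j) a
    arc-OS a j rewrite splitAt-↑ˡ n a m | splitAt-↑ʳ n m j = refl
    arc-SO : ∀ i b → arc g₀ (S i) (O b) ≡ (eqF (w i) b ∨ eqF (w′ i) b)
    arc-SO i b rewrite splitAt-↑ʳ n m i | splitAt-↑ˡ n b m = refl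
    arc-SS : ∀ i j → arc g₀ (S i) (S j) ≡ false
    arc-SS i j rewrite splitAt-↑ʳ n m i | splitAt-↑ʳ n m j = refl
    label-O : ∀ a → l₀ (O a) ≡ nothing
    label-O a rewrite splitAt-↑ˡ n a m = refl
    label-S : ∀ j → l₀ (S j) ≡ just ls
    label-S j rewrite splitAt-↑ʳ n m j = refl

    S↛S : ∀ i j → ¬ Arc g₀ (S i) (S j)
    S↛S i j = false⇒¬true (arc-SS i j)

    O→O : ∀ {a b} → Arc g₀ (O a) (O b) → Arc N a b × rerouted a b ≡ false
    O→O {a} {b} ab with rerouted a b | trans (sym (arc-OO a b)) ab
    ... | false | ab′ = trans (sym (∧-identityʳ (arc N a b))) ab′ , refl
    ... | true  | ab′ = ⊥-elim (false⇒¬true (∧-zeroʳ (arc N a b)) ab′)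

    kept-arc : ∀ {a b} → Arc N a b → rerouted a b ≡ false → Arc g₀ (O a) (O b)
    kept-arc {a} {b} ab r rewrite arc-OO a b | ab | r = refl

    O→S : ∀ j → Arc g₀ (O (v j)) (S j)
    O→S j rewrite arc-OS (v j) j = eqF-refl (v j)

    S→O : ∀ i {b} → IsChild i b → Arc g₀ (S i) (O b)
    S→O i {b} child rewrite arc-SO i b = child⁺ i b child

    child-of-new : ∀ {i b} → Arc g₀ (S i) (O b) → IsChild i b
    child-of-new {i} {b} ib = child⁻ i b (trans (sym (arc-SO i b)) ib)

    direct-and-rerouted : ∀ {a b k} → Arc g₀ (O a) (O b) → Arc g₀ (S k) (O b) → a ≢ v k
    direct-and-rerouted {b = b} {k} ab kb refl =
      false⇒¬true (proj₂ (O→O ab)) (rerouted⁺ k b (child-of-new kb))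

  project-arc : ∀ x y → Arc g₀ x y → Reach N (project x) (project y)
  project-arc x y xy with extension n x | extension n y
  ... | old a | old b rewrite project-O a | project-O b = proj₁ (O→O xy) ◅ ε
  ... | old a | new j rewrite project-O a | project-S j with eqF-true {a = v j} {b = a} (trans (sym (arc-OS a j)) xy)
  ...   | refl = ε
  project-arc x y xy | new i | old b rewrite project-S i | project-O b = top-child i (child-of-new xy) ◅ ε
  project-arc x y xy | new i | new j = ⊥-elim (S↛S i j xy)

  project-reach : ∀ {x y} → Reach g₀ x y → Reach N (project x) (project y)
  project-reach ε         = ε
  project-reach (xy ◅ y⇝) = project-arc _ _ xy ◅◅ project-reach y⇝

  private
    project-reach-O : ∀ {a b} → Reach g₀ (O a) (O b) → Reach N a b
    project-reach-O {a} {b} a⇝b = subst₂ (Reach N) (project-O a) (project-O b) (project-reach a⇝b)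

    new-not-above-top : ∀ j {x} → Reach g₀ x (O (v j)) → x ≢ S j
    new-not-above-top j ε x≡S = O≢S (v j) j x≡S
    new-not-above-top j (_◅_ {j = z} xz z⇝) refl with extension n z
    ... | new k = S↛S j k xz
    ... | old c = acyclic (v j) c (top-child j (child-of-new xz)) (project-reach-O z⇝)

  acyclic₀ : Acyclic g₀
  acyclic₀ x y xy y⇝x with extension n x | extension n y
  ... | old a | old b = acyclic a b (proj₁ (O→O xy)) (project-reach-O y⇝x)
  ... | new i | old b = acyclic (v i) b (top-child i (child-of-new xy))
                          (subst (Reach N b) (project-S i) (subst (λ t → Reach N t (project (S i))) (project-O b) (project-reach y⇝x)))
  ... | new i | new j = S↛S i j xy
  ... | old a | new j with eqF-true {a = v j} {b = a} (trans (sym (arc-OS a j)) xy)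
  ...   | refl = new-not-above-top j y⇝x refl

  indeg-O : ∀ b → indeg g₀ (O b) ≡ indeg N b
  indeg-O b = countB-bij (λ y → arc g₀ y (O b)) (λ a → arc N a b) project maps injective onto
    where
    maps : ∀ y → Arc g₀ y (O b) → Arc N (project y) b
    maps y yb with extension n y
    ... | old a rewrite project-O a = proj₁ (O→O yb)
    ... | new i rewrite project-S i = top-child i (child-of-new yb)
    injective : ∀ y₁ y₂ → Arc g₀ y₁ (O b) → Arc g₀ y₂ (O b) → project y₁ ≡ project y₂ → y₁ ≡ y₂
    injective y₁ y₂ y₁b y₂b e with extension n y₁ | extension n y₂
    ... | old a | old c rewrite project-O a | project-O c = cong O e
    ... | new i | new k rewrite project-S i | project-S k =
      cong S (same-new-vertex i k e (child-of-new y₁b) (child-of-new y₂b))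
    ... | old a | new k rewrite project-O a | project-S k = ⊥-elim (direct-and-rerouted y₁b y₂b e)
    ... | new i | old c rewrite project-S i | project-O c = ⊥-elim (direct-and-rerouted y₂b y₁b (sym e))
    onto : ∀ a → Arc N a b → Σ (Vtx g₀) λ y → Arc g₀ y (O b) × project y ≡ a
    onto a ab with rerouted a b in r
    ... | false = O a , kept-arc ab r , project-O a
    ... | true with rerouted⁻ a b r
    ...   | i , refl , child = S i , S→O i child , project-S i

  indeg-S : ∀ j → indeg g₀ (S j) ≡ 1
  indeg-S j = countB-one (λ y → arc g₀ y (S j)) (O (v j)) (O→S j) only-top
    where
    only-top : ∀ y → Arc g₀ y (S j) → y ≡ O (v j)
    only-top y yj with extension n y
    ... | old a = cong O (sym (eqF-true (trans (sym (arc-OS a j)) yj)))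
    ... | new i = ⊥-elim (S↛S i j yj)

  outdeg-S : ∀ i → outdeg g₀ (S i) ≡ 2
  outdeg-S i = countB-two (arc g₀ (S i)) (O (w i)) (O (w′ i)) (w≢w′ i ∘ O-injective)
                          (S→O i (inj₁ refl)) (S→O i (inj₂ refl)) only-children
    where
    only-children : ∀ z → Arc g₀ (S i) z → z ≡ O (w i) ⊎ z ≡ O (w′ i)
    only-children z iz with extension n z
    ... | new k = ⊥-elim (S↛S i k iz)
    ... | old b with child-of-new iz
    ...   | inj₁ refl = inj₁ refl
    ...   | inj₂ refl = inj₂ refl

  outdeg-O : ∀ a → (∀ i → v i ≢ a) → outdeg g₀ (O a) ≡ outdeg N a
  outdeg-O a not-top = countB-bij (arc g₀ (O a)) (arc N a) project maps injective onto
    where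
    O↛S : ∀ j → ¬ Arc g₀ (O a) (S j)
    O↛S j aj = not-top j (eqF-true (trans (sym (arc-OS a j)) aj))
    maps : ∀ y → Arc g₀ (O a) y → Arc N a (project y)
    maps y ay with extension n y
    ... | old b rewrite project-O b = proj₁ (O→O ay)
    ... | new j = ⊥-elim (O↛S j ay)
    injective : ∀ y₁ y₂ → Arc g₀ (O a) y₁ → Arc g₀ (O a) y₂ → project y₁ ≡ project y₂ → y₁ ≡ y₂
    injective y₁ y₂ ay₁ ay₂ e with extension n y₁ | extension n y₂
    ... | old b | old c rewrite project-O b | project-O c = cong O e
    ... | new j | _     = ⊥-elim (O↛S j ay₁)
    ... | _     | new j = ⊥-elim (O↛S j ay₂)
    onto : ∀ b → Arc N a b → Σ (Vtx g₀) λ y → Arc g₀ (O a) y × project y ≡ b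
    onto b ab with rerouted a b in r
    ... | false = O b , kept-arc ab r , project-O b
    ... | true with rerouted⁻ a b r
    ...   | i , vi≡a , _ = ⊥-elim (not-top i vi≡a)

  lift-reach : ∀ {a b} → Reach N a b → Reach g₀ (O a) (O b)
  lift-reach ε = ε
  lift-reach {a} (_◅_ {j = c} ac c⇝) with rerouted a c in r
  ... | false = kept-arc ac r ◅ lift-reach c⇝
  ... | true with rerouted⁻ a c r
  ...   | i , refl , child = O→S i ◅ (S→O i child ◅ lift-reach c⇝)

  private
    reachN : ∀ u → Reach N root u
    reachN = proj₂ (proj₂ isRoot)

    reach₀ : ∀ x → Reach g₀ (O root) x
    reach₀ x with extension n x
    ... | old b = lift-reach (reachN b)
    ... | new j = lift-reach (reachN (v j)) ◅◅ (O→S j ◅ ε)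

    indeg-1-or-2₀ : ∀ x → x ≢ O root → indeg g₀ x ≡ 1 ⊎ indeg g₀ x ≡ 2
    indeg-1-or-2₀ x x≢Oroot with extension n x
    ... | old b rewrite indeg-O b = cactus-indeg-1-or-2 cactusN b (x≢Oroot ∘ cong O)
    ... | new j = inj₁ (indeg-S j)

    label-fits₀ : ∀ x → LabelFits (l₀ x) (outdeg g₀ x)
    label-fits₀ x with extension n x
    ... | old a rewrite label-O a = tt
    ... | new i rewrite label-S i | outdeg-S i = (λ ()) , (λ ())

    -- A vertex a of N whose only child b is a reticulation would be a tree vertex with
    -- one child (impossible: no elementary vertices), a reticulation with one child
    -- (impossible in a cactus), or the root (then the other parent of b lies below a).
    below-unary-N : ∀ {a b} → outdeg N a ≡ 1 → Arc N a b → indeg N b ≢ 2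
    below-unary-N {a} oa ab ib with a ≟F root
    ... | yes refl with countB-another (λ c → arc N c _) ib ab
    ...   | q , qb , q≢a = unary-not-above-coparent acyclic oa ab qb q≢a (reachN q)
    below-unary-N {a} oa ab ib | no a≢root with cactus-indeg-1-or-2 cactusN a a≢root
    ... | inj₁ ia = no-elementary a (ia , oa)
    ... | inj₂ ia = no-reticulation-below-unary-reticulation cactusN ia oa ab ib

    not-reticulation-below-unary₀ : ∀ p b → Arc g₀ p (O b) → outdeg g₀ p ≡ 1 → indeg g₀ (O b) ≢ 2
    not-reticulation-below-unary₀ p b pb o with extension n p
    ... | new i with trans (sym (outdeg-S i)) o
    ...   | ()
    not-reticulation-below-unary₀ p b pb o | old a with any? (λ i → v i ≟F a)
    ... | yes (i , refl) = λ _ → O≢S b i (countB≡1 (arc g₀ (O (v i))) o (O→S i) pb)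
    ... | no not-top rewrite indeg-O b =
      below-unary-N (trans (sym (outdeg-O a λ i vi≡a → not-top (i , vi≡a))) o) (proj₁ (O→O pb))

    below-unary₀ : ∀ p u → Arc g₀ p u → outdeg g₀ p ≡ 1 → indeg g₀ u ≢ 2 × l₀ u ≢ just lz
    below-unary₀ p u pu o with extension n u
    ... | new j rewrite indeg-S j | label-S j = (λ ()) , (λ ())
    ... | old b rewrite label-O b = not-reticulation-below-unary₀ p b pu o , (λ ())

  preSpecial₀ : PreSpecial g₀ l₀
  preSpecial₀ = record
    { acyclic      = acyclic₀
    ; root         = O root
    ; root-indeg   = trans (indeg-O root) (proj₁ isRoot)
    ; indeg-1-or-2 = indeg-1-or-2₀
    ; reach        = reach₀
    ; label-fits   = label-fits₀
    ; below-unary  = below-unary₀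
    }


lemma1 : (N : Graph) → RootedCactus N → NoElementary N →
         (ρ : UnfoldingRun N) → Special (labelledUnfolding N ρ)
lemma1 N cactusN no-elementary ρ
  with preSpecial-run (AStep.preSpecial₀ cactusN no-elementary (UnfoldingRun.choiceA ρ)) (UnfoldingRun.run ρ)
... | inv , no-reticulation = special-of-preSpecial inv no-reticulation
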